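{- For every $\varepsilon\in(0,1)$ and positive integers $m\ge h$ there exists a positive integer $M=M(\varepsilon,m,h)$ such that the following holds. Suppose that we have nonempty finite sets $\mathcal{P}^{rs}$ for $1\le r<s\le M$ and further sets $\mathcal{P}^{rs}_{t}\subseteq\mathcal{P}^{rs}$ with $|\mathcal{P}^{rs}_{t}|\ge\varepsilon|\mathcal{P}^{rs}|$ for $1\le r<s<t\le M$. Then there are indices $n_1<\dots<n_m$ in $[M]$ and elements $P^{n_rn_s}\in\mathcal{P}^{n_rn_s}$ for $1\le r<s\le h$ such that \[ P^{n_rn_s}\in\bigcap_{t\in(s,m]}\mathcal{P}^{n_rn_s}_{n_t}\quad\text{for all }1\le r<s\le h. \]
   Formalization: The parameter ε ranges only over the rational numbers in the interval (0,1). -}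

module Defs where

open import Data.Nat using (ℕ)
open import Data.Integer using (+_)
open import Data.Rational using (ℚ; _/_)

ℕ→ℚ : ℕ → ℚ
ℕ→ℚ n = (+ n) / 1

module Submission where

-- A positive rational ε is (1+p)/(1+b) for some p and b, so every density hypothesis
-- ε·|𝒫^{rs}| ≤ |𝒫^{rs}_t| yields the integer bound |𝒫^{rs}| ≤ B·|𝒫^{rs}_t| with B = 1+b
-- (density-bound).
-- The indices are then chosen greedily, each time the least remaining candidate c.
-- For every earlier index r an element of 𝒫^{rc} must be fixed that lies in 𝒫^{rc}_t
-- for all later indices t.  By double counting, subsets of density 1/B belonging to
-- B·X candidates have an element common to X of them (pigeonhole); doing this for the
-- j earlier indices in turn (common-choice) keeps a B^{-j} fraction of the candidates,
-- and only those remain available.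

open import Defs
open import Data.Nat using (ℕ; _≤_; _<_)
open import Data.Fin using (Fin; toℕ)
open import Data.Fin.Subset using (Subset; _∈_; ∣_∣)
open import Data.Rational using (ℚ; 0ℚ; 1ℚ; _*_) renaming (_<_ to _<ℚ_; _≤_ to _≤ℚ_)
open import Data.Product using (Σ; ∃-syntax; _×_)

open import Data.Nat using (zero; suc; z≤n; s≤s; _+_; _^_; _≤?_) renaming (_*_ to _·_)
import Data.Nat.Properties as ℕ
open import Data.Integer using (+_; +[1+_]; -[1+_]; +0; +<+) renaming (_≤_ to _≤ℤ_; _*_ to _·ℤ_)
import Data.Integer.Properties as ℤ
open import Data.Rational using (mkℚ; toℚᵘ; *<*)
open import Data.Rational.Properties using (toℚᵘ-mono-≤; toℚᵘ-homo-*; toℚᵘ-fromℚᵘ)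
open import Data.Rational.Unnormalised as ℚᵘ using (mkℚᵘ; *≤*)
import Data.Rational.Unnormalised.Properties as ℚᵘ
open import Data.Bool using (Bool; true; false; if_then_else_)
open import Data.Fin using (zero; suc; opposite)
open import Data.Fin.Properties using (∀-cons; opposite-prop; toℕ<n)
open import Data.Fin.Subset.Properties using (_∈?_)
open import Data.Vec using ([]; _∷_)
open import Data.Vec.Functional using () renaming (_∷_ to _◂_)
open import Data.List using (List; []; _∷_; length; filter; allFin)
open import Data.List.Properties using (length-tabulate)
open import Data.List.Relation.Unary.All as All using (All; []; _∷_)
open import Data.List.Relation.Unary.All.Properties using (all-filter; filter⁺)
open import Data.List.Relation.Unary.AllPairs using (AllPairs; []; _∷_)
import Data.List.Relation.Unary.AllPairs.Properties as AllPairs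
open import Data.List.Relation.Binary.Sublist.Propositional using (_⊆_; []; _∷_; _∷ʳ_; ⊆-refl; ⊆-trans)
open import Data.List.Relation.Binary.Sublist.Propositional.Properties using (All-resp-⊆; filter-⊆)
open import Data.Product using (_,_; map)
open import Function using (id)
open import Relation.Nullary using (yes; no; does)
open import Relation.Unary using (Decidable)
open import Relation.Binary.PropositionalEquality
open import Algebra.Properties.CommutativeMonoid.Sum ℕ.+-0-commutativeMonoid
  using (sum; sum-syntax; ∑-distrib-+; sum-cong-≗)

ℕ→ℚᵘ : ∀ n → toℚᵘ (ℕ→ℚ n) ℚᵘ.≃ mkℚᵘ (+ n) 0
ℕ→ℚᵘ n = toℚᵘ-fromℚᵘ (mkℚᵘ (+ n) 0)

-- From rational density to an integer ratio: for ε = (1+p)/(1+d), ε·k ≤ s gives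
-- k ≤ (1+p)·k ≤ (1+d)·s, by cross-multiplying in the unnormalised rationals.
density-bound : (ε : ℚ) → 0ℚ <ℚ ε →
  Σ ℕ λ b → ∀ k s → ε * ℕ→ℚ k ≤ℚ ℕ→ℚ s → k ≤ suc b · s
density-bound (mkℚ +0 _ _) (*<* (+<+ ()))
density-bound (mkℚ -[1+ _ ] _ _) (*<* ())
density-bound ε@(mkℚ +[1+ p ] d _) _ = d , bound
  where
  -- the cross-multiplied inequality (1+p)·k·1 ≤ s·(1+d), with its two sides in ℕ
  lhs : ∀ k → (+[1+ p ] ·ℤ + k) ·ℤ + 1 ≡ + (suc p · k)
  lhs k = trans (ℤ.*-identityʳ _) (sym (ℤ.pos-* (suc p) k))
  rhs : ∀ s → + s ·ℤ + suc (d · 1) ≡ + (s · suc d)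
  rhs s = trans (sym (ℤ.pos-* s _)) (cong (λ e → + (s · suc e)) (ℕ.*-identityʳ d))

  bound : ∀ k s → ε * ℕ→ℚ k ≤ℚ ℕ→ℚ s → k ≤ suc d · s
  bound k s εk≤s with ℚᵘ.≤-respʳ-≃ (ℕ→ℚᵘ s) (ℚᵘ.≤-respˡ-≃ (ℚᵘ.*-congˡ {toℚᵘ ε} (ℕ→ℚᵘ k))
                        (ℚᵘ.≤-respˡ-≃ (toℚᵘ-homo-* ε (ℕ→ℚ k)) (toℚᵘ-mono-≤ εk≤s)))
  ... | *≤* cross = begin
    k             ≤⟨ ℕ.m≤m+n k (p · k) ⟩
    suc p · k     ≤⟨ ℤ.drop‿+≤+ (subst₂ _≤ℤ_ (lhs k) (rhs s) cross) ⟩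
    s · suc d     ≡⟨ ℕ.*-comm s (suc d) ⟩
    suc d · s     ∎
    where open ℕ.≤-Reasoning

𝟙 : Bool → ℕ
𝟙 b = if b then 1 else 0

size-as-sum : ∀ {K} (p : Subset K) → ∣ p ∣ ≡ ∑[ x < K ] 𝟙 (does (x ∈? p))
size-as-sum []          = refl
size-as-sum (true ∷ p)  = cong suc (size-as-sum p)
size-as-sum (false ∷ p) = size-as-sum p

length-filter-∷ : ∀ {A : Set} {P : A → Set} (P? : Decidable P) t L →
  length (filter P? (t ∷ L)) ≡ 𝟙 (does (P? t)) + length (filter P? L)
length-filter-∷ P? t L with does (P? t)
... | true  = refl
... | false = refl

cancel-heads : ∀ {a b c d} → a + b ≤ c + d → c ≤ a → b ≤ d
cancel-heads {a} le c≤a = ℕ.+-cancelˡ-≤ a _ _ (ℕ.≤-trans le (ℕ.+-monoˡ-≤ _ c≤a))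

average-witness : ∀ K X (g : Fin (suc K) → ℕ) → suc K · X ≤ sum g → Σ (Fin (suc K)) λ x → X ≤ g x
average-witness zero    X g le = zero , subst₂ _≤_ (ℕ.+-identityʳ X) (ℕ.+-identityʳ (g zero)) le
average-witness (suc K) X g le with X ≤? g zero
... | yes X≤g₀ = zero , X≤g₀
... | no X≰g₀  = map suc id (average-witness K X (λ x → g (suc x)) (cancel-heads le (ℕ.<⇒≤ (ℕ.≰⇒> X≰g₀))))

module Counting {A : Set} {K : ℕ} (f : A → Subset K) where

  count : Fin K → List A → ℕ
  count x L = length (filter (λ t → x ∈? f t) L)

  total-∷ : ∀ t L → ∑[ x < K ] count x (t ∷ L) ≡ ∣ f t ∣ + ∑[ x < K ] count x L
  total-∷ t L = begin
    ∑[ x < K ] count x (t ∷ L)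
      ≡⟨ sum-cong-≗ (λ x → length-filter-∷ (λ t → x ∈? f t) t L) ⟩
    ∑[ x < K ] (𝟙 (does (x ∈? f t)) + count x L)
      ≡⟨ ∑-distrib-+ (λ x → 𝟙 (does (x ∈? f t))) (λ x → count x L) ⟩
    ∑[ x < K ] 𝟙 (does (x ∈? f t)) + ∑[ x < K ] count x L
      ≡⟨ cong (_+ ∑[ x < K ] count x L) (sym (size-as-sum (f t))) ⟩
    ∣ f t ∣ + ∑[ x < K ] count x L ∎
    where open ≡-Reasoning

  total-dense : ∀ B {L} → All (λ t → K ≤ B · ∣ f t ∣) L → length L · K ≤ B · ∑[ x < K ] count x L
  total-dense B {[]}    []               = z≤n
  total-dense B {t ∷ L} (K≤B|ft| ∷ dense) = begin
    K + length L · K                        ≤⟨ ℕ.+-mono-≤ K≤B|ft| (total-dense B dense) ⟩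
    B · ∣ f t ∣ + B · ∑[ x < K ] count x L    ≡⟨ ℕ.*-distribˡ-+ B _ _ ⟨
    B · (∣ f t ∣ + ∑[ x < K ] count x L)      ≡⟨ cong (B ·_) (total-∷ t L) ⟨
    B · ∑[ x < K ] count x (t ∷ L)            ∎
    where open ℕ.≤-Reasoning

pigeonhole : ∀ {A : Set} {K} (f : A → Subset K) b X {L} → 1 ≤ K →
  All (λ t → K ≤ suc b · ∣ f t ∣) L → suc b · X ≤ length L →
  Σ (Fin K) λ x → X ≤ length (filter (λ t → x ∈? f t) L)
pigeonhole {K = suc K} f b X {L} (s≤s z≤n) dense many =
  average-witness K X (λ x → count x L) (ℕ.*-cancelˡ-≤ (suc b) (begin
    suc b · (suc K · X)   ≡⟨ ℕ.*-comm (suc b) (suc K · X) ⟩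
    suc K · X · suc b     ≡⟨ ℕ.*-assoc (suc K) X (suc b) ⟩
    suc K · (X · suc b)   ≡⟨ cong (suc K ·_) (ℕ.*-comm X (suc b)) ⟩
    suc K · (suc b · X)   ≤⟨ ℕ.*-monoʳ-≤ (suc K) many ⟩
    suc K · length L      ≡⟨ ℕ.*-comm (suc K) (length L) ⟩
    length L · suc K      ≤⟨ total-dense (suc b) dense ⟩
    suc b · ∑[ x < suc K ] count x L ∎))
  where
  open Counting f
  open ℕ.≤-Reasoning

AllPairs-resp-⊆ : ∀ {A : Set} {R : A → A → Set} {xs ys} → xs ⊆ ys → AllPairs R ys → AllPairs R xs
AllPairs-resp-⊆ []        []         = []
AllPairs-resp-⊆ (_ ∷ʳ τ)  (_ ∷ Rys)  = AllPairs-resp-⊆ τ Rys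
AllPairs-resp-⊆ (refl ∷ τ) (Ry ∷ Rys) = All-resp-⊆ τ Ry ∷ AllPairs-resp-⊆ τ Rys

-- Simultaneous pigeonhole for j families of dense subsets: applying pigeonhole once per
-- family, each time keeping a 1/B fraction of the items, yields one element per family
-- that is common to the subsets of all X surviving items.
common-choice : ∀ {A : Set} j {K : Fin j → ℕ} (f : (q : Fin j) → A → Subset (K q)) b X {L} →
  (∀ q → 1 ≤ K q) → All (λ t → ∀ q → K q ≤ suc b · ∣ f q t ∣) L → suc b ^ j · X ≤ length L →
  Σ ((q : Fin j) → Fin (K q)) λ x → Σ (List A) λ L' →
    L' ⊆ L × X ≤ length L' × All (λ t → ∀ q → x q ∈ f q t) L'
common-choice zero f b X {L} _ _ many =
  (λ ()) , L , ⊆-refl , subst (_≤ length L) (ℕ.+-identityʳ X) many , All.universal (λ _ ()) L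
common-choice (suc j) f b X {L} K≥1 dense many
  with common-choice j (λ q → f (suc q)) b (suc b · X) (λ q → K≥1 (suc q)) (All.map (λ d q → d (suc q)) dense) many'
  where
  many' : suc b ^ j · (suc b · X) ≤ length L
  many' = subst (_≤ length L) (trans (cong (_· X) (ℕ.*-comm (suc b) (suc b ^ j))) (ℕ.*-assoc (suc b ^ j) (suc b) X)) many
... | x , L₁ , L₁⊆L , many₁ , fits₁
  with pigeonhole (f zero) b X (K≥1 zero) (All-resp-⊆ L₁⊆L (All.map (λ d → d zero) dense)) many₁
... | x₀ , many₀ =
  ∀-cons x₀ x , filter (λ t → x₀ ∈? f zero t) L₁ , ⊆-trans (filter-⊆ _ L₁) L₁⊆L , many₀ ,
  All.zipWith (λ (x₀∈ , x∈) → ∀-cons x₀∈ x∈) (all-filter _ L₁ , filter⁺ _ fits₁)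

_≺_ : ∀ {n} → Fin n → Fin n → Set
i ≺ j = toℕ i < toℕ j

opposite-reverses : ∀ {n} {i j : Fin n} → i ≺ j → opposite j ≺ opposite i
opposite-reverses {i = i} {j} i≺j =
  subst₂ _<_ (sym (opposite-prop j)) (sym (opposite-prop i)) (ℕ.∸-monoʳ-< (s≤s i≺j) (toℕ<n j))

-- a number of candidates that suffices for ℓ further greedy steps after j indices are
-- chosen: a step needs one candidate for the new index and keeps a B^{-j} fraction of
-- the others
enough : ℕ → ℕ → ℕ → ℕ
enough b j zero    = 0
enough b j (suc ℓ) = suc (suc b ^ j · enough b (suc j) ℓ)

module Greedy {M : ℕ} (k : Fin M → Fin M → ℕ) (k≥1 : ∀ r s → r ≺ s → 1 ≤ k r s)
  (S : (r s t : Fin M) → Subset (k r s)) (b : ℕ)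
  (dense : ∀ r s t → r ≺ s → s ≺ t → k r s ≤ suc b · ∣ S r s t ∣) where

  -- choices for the pairs of a decreasing sequence of j indices: for positions p ≺ q
  -- (index q earlier, so smaller) an element of the set belonging to the pair
  Choice : ∀ {j} → (Fin j → Fin M) → Set
  Choice {j} chosen = (p q : Fin j) → p ≺ q → Fin (k (chosen q) (chosen p))

  Respects : ∀ {j} (chosen : Fin j → Fin M) → Choice chosen → Fin M → Set
  Respects chosen choice t = ∀ p q (p≺q : p ≺ q) → choice p q p≺q ∈ S (chosen q) (chosen p) t

  -- the state after j greedy steps: the chosen indices, most recent first, the choices
  -- for their pairs, and the candidates that remain available for later steps
  record Stage (j : ℕ) : Set where
    constructor stage
    field
      chosen     : Fin j → Fin M
      choice     : Choice chosen
      candidates : List (Fin M)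
      decreasing : ∀ p q → p ≺ q → chosen q ≺ chosen p
      settled    : ∀ u p q → u ≺ p → (p≺q : p ≺ q) → choice p q p≺q ∈ S (chosen q) (chosen p) (chosen u)
      above      : All (λ t → ∀ p → chosen p ≺ t) candidates
      sorted     : AllPairs _≺_ candidates
      respected  : All (Respects chosen choice) candidates

  open Stage

  initial : Stage 0
  initial = stage (λ ()) (λ ()) (allFin M) (λ ()) (λ ()) (All.universal (λ _ ()) _)
                  (AllPairs.tabulate⁺-< id) (All.universal (λ _ ()) _)

  -- One greedy step: the least candidate c becomes the next index, and common-choice
  -- fixes the choices for the pairs (earlier index, c) so that X of the other
  -- candidates, out of B^j·X, respect them.
  extend : ∀ {j} X (σ : Stage j) → suc (suc b ^ j · X) ≤ length (candidates σ) →
    Σ (Stage (suc j)) λ σ' → X ≤ length (candidates σ')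
  extend {j} X (stage chosen choice (c ∷ C) decreasing settled
                      (c-above ∷ above) (c≺C ∷ sorted) (c-respects ∷ respected)) (s≤s many)
    with common-choice j (λ q t → S (chosen q) c t) b X (λ q → k≥1 _ _ (c-above q))
           (All.map (λ c≺t q → dense _ _ _ (c-above q) c≺t) c≺C) many
  ... | x , C' , C'⊆C , many' , fits =
    stage (c ◂ chosen) choice' C' decreasing' settled' above' (AllPairs-resp-⊆ C'⊆C sorted) respected'
      , many'
    where
    choice' : Choice (c ◂ chosen)
    choice' zero    (suc q) _         = x q
    choice' (suc p) (suc q) (s≤s p≺q) = choice p q p≺q

    decreasing' : ∀ p q → p ≺ q → (c ◂ chosen) q ≺ (c ◂ chosen) p
    decreasing' zero    (suc q) _         = c-above q
    decreasing' (suc p) (suc q) (s≤s p≺q) = decreasing p q p≺q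

    settled' : ∀ u p q → u ≺ p → (p≺q : p ≺ q) →
      choice' p q p≺q ∈ S ((c ◂ chosen) q) ((c ◂ chosen) p) ((c ◂ chosen) u)
    settled' zero    (suc p) (suc q) _         (s≤s p≺q) = c-respects p q p≺q
    settled' (suc u) (suc p) (suc q) (s≤s u≺p) (s≤s p≺q) = settled u p q u≺p p≺q

    above' : All (λ t → ∀ p → (c ◂ chosen) p ≺ t) C'
    above' = All-resp-⊆ C'⊆C (All.zipWith (λ (c≺t , chosen≺t) → ∀-cons c≺t chosen≺t) (c≺C , above))

    respects' : ∀ {t} → (∀ q → x q ∈ S (chosen q) c t) × Respects chosen choice t →
      Respects (c ◂ chosen) choice' t
    respects' (fits-t , _)    zero    (suc q) _         = fits-t q
    respects' (_ , respects-t) (suc p) (suc q) (s≤s p≺q) = respects-t p q p≺q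

    respected' : All (Respects (c ◂ chosen) choice') C'
    respected' = All.zipWith respects' (fits , All-resp-⊆ C'⊆C respected)

  complete : ∀ ℓ {j} (σ : Stage j) → enough b j ℓ ≤ length (candidates σ) → Stage (ℓ + j)
  complete zero    σ _ = σ
  complete (suc ℓ) {j} σ many with extend (enough b (suc j) ℓ) σ many
  ... | σ' , many' = subst Stage (ℕ.+-suc ℓ j) (complete ℓ σ' many')

  -- read in reverse, the indices chosen in m steps form the required increasing
  -- sequence, and the settled choices are the required elements
  solution : ∀ {m} → Stage m →
    Σ (Fin m → Fin M) λ n → ((i j : Fin m) → i ≺ j → n i ≺ n j) ×
      Σ ((r s : Fin m) → r ≺ s → Fin (k (n r) (n s))) λ P →
        ∀ r s (r≺s : r ≺ s) t → s ≺ t → P r s r≺s ∈ S (n r) (n s) (n t)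
  solution σ =
    (λ i → chosen σ (opposite i)) ,
    (λ i j i≺j → decreasing σ _ _ (opposite-reverses i≺j)) ,
    (λ r s r≺s → choice σ (opposite s) (opposite r) (opposite-reverses r≺s)) ,
    (λ r s r≺s t s≺t → settled σ _ _ _ (opposite-reverses s≺t) (opposite-reverses r≺s))

greedy-sequence : ∀ b m {M} → enough b 0 m ≤ M →
  (k : Fin M → Fin M → ℕ) → (∀ r s → r ≺ s → 1 ≤ k r s) →
  (S : (r s t : Fin M) → Subset (k r s)) →
  (∀ r s t → r ≺ s → s ≺ t → k r s ≤ suc b · ∣ S r s t ∣) →
  Σ (Fin m → Fin M) λ n → ((i j : Fin m) → i ≺ j → n i ≺ n j) ×
    Σ ((r s : Fin m) → r ≺ s → Fin (k (n r) (n s))) λ P →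
      ∀ r s (r≺s : r ≺ s) t → s ≺ t → P r s r≺s ∈ S (n r) (n s) (n t)
greedy-sequence b m {M} M-large k k≥1 S dense =
  solution (subst Stage (ℕ.+-identityʳ m) (complete m initial M-large'))
  where
  open Greedy k k≥1 S b dense
  M-large' : enough b 0 m ≤ length (allFin M)
  M-large' = subst (enough b 0 m ≤_) (sym (length-tabulate id)) M-large

lemma4p1 : (ε : ℚ) → 0ℚ <ℚ ε → ε <ℚ 1ℚ → (m h : ℕ) → 1 ≤ h → h ≤ m →
    Σ ℕ λ M → (1 ≤ M ×
      ((k : Fin M → Fin M → ℕ) →
       ((r s : Fin M) → toℕ r < toℕ s → 1 ≤ k r s) →
       (S : (r s t : Fin M) → Subset (k r s)) →
       ((r s t : Fin M) → toℕ r < toℕ s → toℕ s < toℕ t →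
          ε * ℕ→ℚ (k r s) ≤ℚ ℕ→ℚ ∣ S r s t ∣) →
       Σ (Fin m → Fin M) λ n → (((i j : Fin m) → toℕ i < toℕ j → toℕ (n i) < toℕ (n j)) ×
         Σ ((r s : Fin m) → toℕ r < toℕ s → toℕ s < h → Fin (k (n r) (n s))) λ P →
           (r s : Fin m) → (r<s : toℕ r < toℕ s) → (s<h : toℕ s < h) →
             (t : Fin m) → toℕ s < toℕ t → P r s r<s s<h ∈ S (n r) (n s) (n t))))
lemma4p1 ε 0<ε _ m h 1≤h h≤m with density-bound ε 0<ε
... | b , bound = enough b 0 m , enough-positive m (ℕ.≤-trans 1≤h h≤m) , λ k k≥1 S dense →
  let (n , increasing , P , P∈S) =
        greedy-sequence b m ℕ.≤-refl k k≥1 S (λ r s t r≺s s≺t → bound _ _ (dense r s t r≺s s≺t))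
  in n , increasing , (λ r s r<s _ → P r s r<s) , λ r s r<s _ → P∈S r s r<s
  where
  enough-positive : ∀ ℓ → 1 ≤ ℓ → 1 ≤ enough b 0 ℓ
  enough-positive (suc ℓ) _ = s≤s z≤n
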